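{- Let $f$ and $f'$ be maps on a finite set of $n$ elements, whose functional graphs have component sizes $t=(t_1,\ldots,t_s)$ with respective cycle sizes $c=(c_1,\ldots,c_s)$, and component sizes $t'=(t'_1,\ldots,t'_r)$ with respective cycle sizes $c'=(c'_1,\ldots,c'_r)$. Suppose $(t,c)\prec(t',c')$. Then $H_{f,\infty}<H_{f',\infty}$.
   Context: The functional graph of $g\colon X\to X$ has node set $X$ and directed edges $x\to g(x)$; each connected component (of the underlying undirected graph) contains exactly one cycle. If the components have sizes $t_1,\ldots,t_s$ and their cycles sizes $c_1,\ldots,c_s$, with $n=\#X$, the asymptotic iteration entropy is $H_{g,\infty}=\frac1n\sum_{1\le i\le s}t_i\log_2 c_i$. For sequences of positive integers $t=(t_1,\ldots,t_s)$, $c=(c_1,\ldots,c_s)$, $t'=(t'_1,\ldots,t'_r)$, $c'=(c'_1,\ldots,c'_r)$ with $r<s$, $n=\sum_i t_i=\sum_j t'_j$, $c_i\le t_i$ and $c'_j\le t'_j$ for all $i,j$, one writes $(t,c)\prec(t',c')$ if there exist pairwise disjoint sets $S_1,\ldots,S_r\subseteq\{1,\ldots,s\}$ such that $t'_j=\sum_{i\in S_j}t_i$ and $c'_j=\sum_{i\in S_j}c_i$ for $1\le j\le r$. -}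

module Defs where

import Agda.Primitive
open import Data.Nat using (ℕ; zero; suc; _+_; _*_; _^_; _≤_; _<_)
open import Data.Fin using (Fin; toℕ; _≟_)
import Data.Fin as F
open import Data.Fin.Properties using (any?)
open import Data.Bool using (Bool; true; false; if_then_else_)
open import Data.Product using (Σ; ∃; ∃-syntax; _×_; _,_)
open import Data.List using (length; filter; allFin)
open import Relation.Nullary using (Dec)
open import Relation.Nullary.Decidable using (_×-dec_)
open import Relation.Unary using (Pred; Decidable)
open import Relation.Binary.PropositionalEquality using (_≡_)
open import Function.Bundles using (_⇔_)

iter : ∀ {A : Set} → (A → A) → ℕ → A → A
iter g zero    x = x
iter g (suc k) x = g (iter g k x)

sumFin : ∀ {s} → (Fin s → ℕ) → ℕ
sumFin {zero}  a = 0
sumFin {suc s} a = a F.zero + sumFin (λ i → a (F.suc i))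

prodFin : ∀ {s} → (Fin s → ℕ) → ℕ
prodFin {zero}  a = 1
prodFin {suc s} a = a F.zero * prodFin (λ i → a (F.suc i))

count : ∀ {n} {P : Pred (Fin n) Agda.Primitive.lzero} → Decidable P → ℕ
count {n} P? = length (filter P? (allFin n))

-- x and y lie in the same connected component of the functional graph of g
SameComp : ∀ {n} → (Fin n → Fin n) → Fin n → Fin n → Set
SameComp g x y = ∃[ a ] ∃[ b ] (iter g a x ≡ iter g b y)

-- x lies on a cycle of the functional graph of g
-- (some positive iterate returns to x; a period ≤ n always suffices)
OnCycle : ∀ {n} → (Fin n → Fin n) → Fin n → Set
OnCycle {n} g x = ∃[ k ] (iter g (suc (toℕ {n} k)) x ≡ x)

onCycle? : ∀ {n} (g : Fin n → Fin n) → Decidable (OnCycle g)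
onCycle? g x = any? (λ k → iter g (suc (toℕ k)) x ≟ x)

-- The functional graph of g : Fin n → Fin n has exactly s components,
-- listed in the order given by the labelling comp, the i-th of which has
-- t i nodes and a cycle of length c i.
record Components {n} (g : Fin n → Fin n) (s : ℕ) (t c : Fin s → ℕ) : Set where
  field
    comp      : Fin n → Fin s
    comp-surj : ∀ i → ∃[ x ] (comp x ≡ i)
    comp-iff  : ∀ x y → (comp x ≡ comp y) ⇔ SameComp g x y
    size      : ∀ i → t i ≡ count (λ x → comp x ≟ i)
    cycleSize : ∀ i → c i ≡ count (λ x → (comp x ≟ i) ×-dec onCycle? g x)

-- (t,c) ≺ (t',c'): r < s and there are pairwise disjoint S_1..S_r ⊆ {1..s}
-- (S j i ≡ true means i ∈ S_j) with t'_j = Σ_{i∈S_j} t_i, c'_j = Σ_{i∈S_j} c_i.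
Prec : (s r : ℕ) → (t c : Fin s → ℕ) → (t' c' : Fin r → ℕ) → Set
Prec s r t c t' c' =
  r < s ×
  Σ (Fin r → Fin s → Bool) λ S →
    (∀ j j' i → S j i ≡ true → S j' i ≡ true → j ≡ j') ×
    (∀ j → t' j ≡ sumFin (λ i → if S j i then t i else 0)) ×
    (∀ j → c' j ≡ sumFin (λ i → if S j i then c i else 0))

-- 2^(n · H_{g,∞}) = ∏_i c_i^{t_i}  (H_{g,∞} = (1/n) Σ t_i log₂ c_i)
expEntropy : ∀ {s} → (t c : Fin s → ℕ) → ℕ
expEntropy t c = prodFin (λ i → c i ^ t i)

-- Compare 2^(n·H) = ∏ᵢ cᵢ^tᵢ for both maps. Every component contains a
-- cycle (iterating any point eventually repeats), so tᵢ, cᵢ ≥ 1. As the t'ⱼ and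
-- the tᵢ both sum to n and the blocks Sⱼ are disjoint, every index i lies in some
-- block σ i, and regrouping gives ∏ⱼ c'ⱼ^t'ⱼ = ∏ᵢ ∏ⱼ c'ⱼ^[i ∈ Sⱼ]·tᵢ ≥ ∏ᵢ c'_{σ i}^tᵢ.
-- Each factor dominates cᵢ^tᵢ since c'_{σ i} ≥ cᵢ, and as r < s some block
-- contains two indices i₁ ≠ i₂, so c'_{σ i₁} ≥ c_{i₁} + c_{i₂} > c_{i₁}.
{-# OPTIONS --safe #-}
module Submission where

open import Defs
open import Level using (0ℓ)
open import Data.Nat using (ℕ; zero; suc; _+_; _*_; _^_; _∸_; _≤_; _<_; z≤n; z<s; s≤s⁻¹; >-nonZero)
open import Data.Nat.Properties hiding (_≟_)
open import Data.Fin using (Fin; zero; suc; toℕ; fromℕ<; _≟_)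
open import Data.Fin.Properties using (any?; pigeonhole; toℕ<n; toℕ-fromℕ<)
import Data.Fin.Properties as Finₚ
open import Data.Bool using (Bool; true; false; if_then_else_)
import Data.Bool.Properties as Boolₚ
open import Data.Product using (∃-syntax; _,_; proj₁; proj₂)
open import Data.List using (length; filter; tabulate)
open import Relation.Nullary using (Dec; yes; no; does; contradiction)
open import Relation.Nullary.Decidable using (dec-true; _×-dec_)
open import Relation.Unary using (Pred; Decidable)
open import Relation.Binary.PropositionalEquality
open import Function using (_∘_; id; flip)
open import Function.Bundles using (Equivalence)
import Algebra.Properties.CommutativeMonoid.Sum as CommutativeMonoidSum

module + = CommutativeMonoidSum +-0-commutativeMonoid
module * = CommutativeMonoidSum *-1-commutativeMonoid

sumFin≡sum : ∀ {s} (a : Fin s → ℕ) → sumFin a ≡ +.sum a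
sumFin≡sum {zero}  a = refl
sumFin≡sum {suc s} a = cong (a zero +_) (sumFin≡sum (a ∘ suc))

prodFin≡prod : ∀ {s} (a : Fin s → ℕ) → prodFin a ≡ *.sum a
prodFin≡prod {zero}  a = refl
prodFin≡prod {suc s} a = cong (a zero *_) (prodFin≡prod (a ∘ suc))

sumFin-cong : ∀ {s} {a b : Fin s → ℕ} → (∀ i → a i ≡ b i) → sumFin a ≡ sumFin b
sumFin-cong {a = a} {b} a≗b =
  trans (sumFin≡sum a) (trans (+.sum-cong-≗ a≗b) (sym (sumFin≡sum b)))

prodFin-cong : ∀ {s} {a b : Fin s → ℕ} → (∀ i → a i ≡ b i) → prodFin a ≡ prodFin b
prodFin-cong {a = a} {b} a≗b =
  trans (prodFin≡prod a) (trans (*.sum-cong-≗ a≗b) (sym (prodFin≡prod b)))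

sumFin-comm : ∀ {s r} (h : Fin s → Fin r → ℕ) →
  sumFin (λ i → sumFin (h i)) ≡ sumFin (λ j → sumFin (λ i → h i j))
sumFin-comm h = begin
  sumFin (λ i → sumFin (h i))         ≡⟨ sumFin≡sum (λ i → sumFin (h i)) ⟩
  +.sum (λ i → sumFin (h i))          ≡⟨ +.sum-cong-≗ (λ i → sumFin≡sum (h i)) ⟩
  +.sum (λ i → +.sum (h i))           ≡⟨ +.∑-comm h ⟩
  +.sum (λ j → +.sum (λ i → h i j))   ≡⟨ +.sum-cong-≗ (λ j → sumFin≡sum (λ i → h i j)) ⟨
  +.sum (λ j → sumFin (λ i → h i j))  ≡⟨ sumFin≡sum (λ j → sumFin (λ i → h i j)) ⟨
  sumFin (λ j → sumFin (λ i → h i j)) ∎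
  where open ≡-Reasoning

prodFin-comm : ∀ {s r} (h : Fin s → Fin r → ℕ) →
  prodFin (λ i → prodFin (h i)) ≡ prodFin (λ j → prodFin (λ i → h i j))
prodFin-comm h = begin
  prodFin (λ i → prodFin (h i))         ≡⟨ prodFin≡prod (λ i → prodFin (h i)) ⟩
  *.sum (λ i → prodFin (h i))           ≡⟨ *.sum-cong-≗ (λ i → prodFin≡prod (h i)) ⟩
  *.sum (λ i → *.sum (h i))             ≡⟨ *.∑-comm h ⟩
  *.sum (λ j → *.sum (λ i → h i j))     ≡⟨ *.sum-cong-≗ (λ j → prodFin≡prod (λ i → h i j)) ⟨
  *.sum (λ j → prodFin (λ i → h i j))   ≡⟨ prodFin≡prod (λ j → prodFin (λ i → h i j)) ⟨
  prodFin (λ j → prodFin (λ i → h i j)) ∎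
  where open ≡-Reasoning

sumFin-const : ∀ s x → sumFin {s} (λ _ → x) ≡ s * x
sumFin-const zero    x = refl
sumFin-const (suc s) x = cong (x +_) (sumFin-const s x)

^-distribˡ-sumFin : ∀ {s} x (a : Fin s → ℕ) → x ^ sumFin a ≡ prodFin (λ i → x ^ a i)
^-distribˡ-sumFin {zero}  x a = refl
^-distribˡ-sumFin {suc s} x a =
  trans (^-distribˡ-+-* x (a zero) _) (cong (x ^ a zero *_) (^-distribˡ-sumFin x (a ∘ suc)))

term≤sumFin : ∀ {s} (a : Fin s → ℕ) i → a i ≤ sumFin a
term≤sumFin a zero    = m≤m+n _ _
term≤sumFin a (suc i) = ≤-trans (term≤sumFin (a ∘ suc) i) (m≤n+m _ _)

two-terms≤sumFin : ∀ {s} (a : Fin s → ℕ) {i i'} → i ≢ i' → a i + a i' ≤ sumFin a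
two-terms≤sumFin a {zero}  {zero}   i≢i' = contradiction refl i≢i'
two-terms≤sumFin a {zero}  {suc i'} _    = +-monoʳ-≤ (a zero) (term≤sumFin (a ∘ suc) i')
two-terms≤sumFin a {suc i} {zero}   _    =
  subst (_≤ sumFin a) (+-comm (a zero) (a (suc i))) (+-monoʳ-≤ (a zero) (term≤sumFin (a ∘ suc) i))
two-terms≤sumFin a {suc i} {suc i'} i≢i' =
  ≤-trans (two-terms≤sumFin (a ∘ suc) (i≢i' ∘ cong suc)) (m≤n+m _ _)

sumFin-mono-≤ : ∀ {s} {a b : Fin s → ℕ} → (∀ i → a i ≤ b i) → sumFin a ≤ sumFin b
sumFin-mono-≤ {zero}  a≤b = z≤n
sumFin-mono-≤ {suc s} a≤b = +-mono-≤ (a≤b zero) (sumFin-mono-≤ (a≤b ∘ suc))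

sumFin-mono-< : ∀ {s} {a b : Fin s → ℕ} → (∀ i → a i ≤ b i) → ∀ i → a i < b i → sumFin a < sumFin b
sumFin-mono-< a≤b zero    a<b = +-mono-<-≤ a<b (sumFin-mono-≤ (a≤b ∘ suc))
sumFin-mono-< a≤b (suc i) a<b = +-mono-≤-< (a≤b zero) (sumFin-mono-< (a≤b ∘ suc) i a<b)

sumFin-if-false : ∀ {r} (b : Fin r → Bool) x → (∀ j → b j ≡ false) →
  sumFin (λ j → if b j then x else 0) ≡ 0
sumFin-if-false {zero}  b x b≡false = refl
sumFin-if-false {suc r} b x b≡false rewrite b≡false zero =
  sumFin-if-false (b ∘ suc) x (b≡false ∘ suc)

sumFin-if-unique-≤ : ∀ {r} (b : Fin r → Bool) x → (∀ j j' → b j ≡ true → b j' ≡ true → j ≡ j') →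
  sumFin (λ j → if b j then x else 0) ≤ x
sumFin-if-unique-≤ {zero}  b x atMostOne = z≤n
sumFin-if-unique-≤ {suc r} b x atMostOne with b zero in b₀
... | true  = ≤-reflexive (trans (cong (x +_) rest≡0) (+-identityʳ x))
  where
  rest≡0 : sumFin (λ j → if b (suc j) then x else 0) ≡ 0
  rest≡0 = sumFin-if-false (b ∘ suc) x
    (λ j → Boolₚ.¬-not (λ bⱼ → Finₚ.0≢1+n (atMostOne zero (suc j) b₀ bⱼ)))
... | false = sumFin-if-unique-≤ (b ∘ suc) x
    (λ j j' bⱼ bⱼ' → Finₚ.suc-injective (atMostOne (suc j) (suc j') bⱼ bⱼ'))

prodFin-pos : ∀ {s} {a : Fin s → ℕ} → (∀ i → 1 ≤ a i) → 1 ≤ prodFin a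
prodFin-pos {zero}  a≥1 = ≤-refl
prodFin-pos {suc s} a≥1 = *-mono-≤ (a≥1 zero) (prodFin-pos (a≥1 ∘ suc))

factor≤prodFin : ∀ {s} {a : Fin s → ℕ} → (∀ i → 1 ≤ a i) → ∀ i → a i ≤ prodFin a
factor≤prodFin {a = a} a≥1 zero =
  subst (_≤ prodFin a) (*-identityʳ (a zero)) (*-monoʳ-≤ (a zero) (prodFin-pos (a≥1 ∘ suc)))
factor≤prodFin {a = a} a≥1 (suc i) =
  ≤-trans (factor≤prodFin (a≥1 ∘ suc) i) (m≤n*m _ _ {{>-nonZero (a≥1 zero)}})

prodFin-mono-≤ : ∀ {s} {a b : Fin s → ℕ} → (∀ i → a i ≤ b i) → prodFin a ≤ prodFin b
prodFin-mono-≤ {zero}  a≤b = ≤-refl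
prodFin-mono-≤ {suc s} a≤b = *-mono-≤ (a≤b zero) (prodFin-mono-≤ (a≤b ∘ suc))

prodFin-mono-< : ∀ {s} {a b : Fin s → ℕ} → (∀ i → 1 ≤ a i) → (∀ i → a i ≤ b i) →
  ∀ i → a i < b i → prodFin a < prodFin b
prodFin-mono-< {a = a} {b} a≥1 a≤b zero a<b = begin-strict
  a zero * prodFin (a ∘ suc)  <⟨ *-monoˡ-< _ {{>-nonZero (prodFin-pos (a≥1 ∘ suc))}} a<b ⟩
  b zero * prodFin (a ∘ suc)  ≤⟨ *-monoʳ-≤ (b zero) (prodFin-mono-≤ (a≤b ∘ suc)) ⟩
  b zero * prodFin (b ∘ suc)  ∎
  where open ≤-Reasoning
prodFin-mono-< {a = a} {b} a≥1 a≤b (suc i) a<b = begin-strict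
  a zero * prodFin (a ∘ suc)  <⟨ *-monoʳ-< (a zero) {{>-nonZero (a≥1 zero)}}
                                       (prodFin-mono-< (a≥1 ∘ suc) (a≤b ∘ suc) i a<b) ⟩
  a zero * prodFin (b ∘ suc)  ≤⟨ *-monoˡ-≤ (prodFin (b ∘ suc)) (a≤b zero) ⟩
  b zero * prodFin (b ∘ suc)  ∎
  where open ≤-Reasoning

indicator : ∀ {p} {P : Set p} → Dec P → ℕ
indicator P? = if does P? then 1 else 0

length-filter-tabulate : ∀ {A : Set} {P : Pred A 0ℓ} (P? : Decidable P) {n} (f : Fin n → A) →
  length (filter P? (tabulate f)) ≡ sumFin (λ x → indicator (P? (f x)))
length-filter-tabulate P? {zero}  f = refl
length-filter-tabulate P? {suc n} f with does (P? (f zero))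
... | true  = cong suc (length-filter-tabulate P? (f ∘ suc))
... | false = length-filter-tabulate P? (f ∘ suc)

count≡sumFin : ∀ {n} {P : Pred (Fin n) 0ℓ} (P? : Decidable P) → count P? ≡ sumFin (indicator ∘ P?)
count≡sumFin P? = length-filter-tabulate P? id

1≤count : ∀ {n} {P : Pred (Fin n) 0ℓ} (P? : Decidable P) {x} → P x → 1 ≤ count P?
1≤count P? {x} px = begin
  1                         ≡⟨ cong (λ b → if b then 1 else 0) (dec-true (P? x) px) ⟨
  indicator (P? x)          ≤⟨ term≤sumFin (indicator ∘ P?) x ⟩
  sumFin (indicator ∘ P?)   ≡⟨ count≡sumFin P? ⟨
  count P?                  ∎
  where open ≤-Reasoning

sumFin-indicator-≟ : ∀ {s} (k : Fin s) → sumFin (λ i → indicator (k ≟ i)) ≡ 1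
sumFin-indicator-≟ {suc s} zero    = cong suc (trans (sumFin-const s 0) (*-zeroʳ s))
sumFin-indicator-≟ {suc s} (suc k) = sumFin-indicator-≟ k

iter-+ : ∀ {A : Set} (g : A → A) m k x → iter g (m + k) x ≡ iter g m (iter g k x)
iter-+ g zero    k x = refl
iter-+ g (suc m) k x = cong g (iter-+ g m k x)

iter-eventually-onCycle : ∀ {n} (g : Fin n → Fin n) x → ∃[ a ] OnCycle g (iter g a x)
iter-eventually-onCycle {n} g x with pigeonhole (n<1+n n) (λ k → iter g (toℕ k) x)
... | k₁ , k₂ , k₁<k₂ , gᵃx≡gᵇx = a , fromℕ< d<n , returns
  where
  a = toℕ k₁
  b = toℕ k₂
  d = b ∸ suc a
  d+1+a≡b : d + suc a ≡ b
  d+1+a≡b = m∸n+n≡m k₁<k₂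
  d<n : d < n
  d<n = <-≤-trans (subst (d <_) d+1+a≡b (m<m+n d z<s)) (s≤s⁻¹ (toℕ<n k₂))
  returns : iter g (suc (toℕ (fromℕ< d<n))) (iter g a x) ≡ iter g a x
  returns = begin
    iter g (suc (toℕ (fromℕ< d<n))) (iter g a x) ≡⟨ cong (λ m → iter g (suc m) (iter g a x)) (toℕ-fromℕ< d<n) ⟩
    iter g (suc d) (iter g a x)                  ≡⟨ iter-+ g (suc d) a x ⟨
    iter g (suc d + a) x                         ≡⟨ cong (λ m → iter g m x) (+-suc d a) ⟨
    iter g (d + suc a) x                         ≡⟨ cong (λ m → iter g m x) d+1+a≡b ⟩
    iter g b x                                   ≡⟨ gᵃx≡gᵇx ⟨
    iter g a x                                   ∎
    where open ≡-Reasoning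

module _ {n} {g : Fin n → Fin n} {s} {t c : Fin s → ℕ} (C : Components g s t c) where
  open Components C

  size-pos : ∀ i → 1 ≤ t i
  size-pos i with comp-surj i
  ... | x , compx≡i = subst (1 ≤_) (sym (size i)) (1≤count (λ x → comp x ≟ i) compx≡i)

  cycleSize-pos : ∀ i → 1 ≤ c i
  cycleSize-pos i with comp-surj i
  ... | x , compx≡i with iter-eventually-onCycle g x
  ... | a , onCycle =
    subst (1 ≤_) (sym (cycleSize i))
      (1≤count (λ x → (comp x ≟ i) ×-dec onCycle? g x) (sameComp , onCycle))
    where
    sameComp : comp (iter g a x) ≡ i
    sameComp = trans (Equivalence.from (comp-iff (iter g a x) x) (0 , a , refl)) compx≡i

  sumFin-size : sumFin t ≡ n
  sumFin-size = begin
    sumFin t                                            ≡⟨ sumFin-cong (λ i → trans (size i) (count≡sumFin (∈comp i))) ⟩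
    sumFin (λ i → sumFin (indicator ∘ ∈comp i))         ≡⟨ sumFin-comm (λ i → indicator ∘ ∈comp i) ⟩
    sumFin (λ x → sumFin (λ i → indicator (∈comp i x))) ≡⟨ sumFin-cong (sumFin-indicator-≟ ∘ comp) ⟩
    sumFin {n} (λ _ → 1)                                ≡⟨ sumFin-const n 1 ⟩
    n * 1                                               ≡⟨ *-identityʳ n ⟩
    n                                                   ∎
    where
    open ≡-Reasoning
    ∈comp : ∀ i x → Dec (comp x ≡ i)
    ∈comp i x = comp x ≟ i

PairwiseDisjoint : ∀ {s r} → (Fin r → Fin s → Bool) → Set
PairwiseDisjoint S = ∀ j j' i → S j i ≡ true → S j' i ≡ true → j ≡ j'

blockSum : ∀ {s r} → (Fin r → Fin s → Bool) → (Fin s → ℕ) → Fin r → ℕ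
blockSum S a j = sumFin (λ i → if S j i then a i else 0)

module _ {s r} (S : Fin r → Fin s → Bool) where

  term≤blockSum : ∀ (a : Fin s → ℕ) {j i} → S j i ≡ true → a i ≤ blockSum S a j
  term≤blockSum a {j} {i} Sji =
    subst (_≤ blockSum S a j) (cong (λ b → if b then a i else 0) Sji) (term≤sumFin _ i)

  two-terms≤blockSum : ∀ (a : Fin s → ℕ) {j i i'} → i ≢ i' → S j i ≡ true → S j i' ≡ true →
    a i + a i' ≤ blockSum S a j
  two-terms≤blockSum a {j} {i} {i'} i≢i' Sji Sji' =
    subst (_≤ blockSum S a j)
      (cong₂ _+_ (cong (λ b → if b then a i else 0) Sji) (cong (λ b → if b then a i' else 0) Sji'))
      (two-terms≤sumFin _ i≢i')

  blocks-cover : PairwiseDisjoint S → ∀ {t : Fin s → ℕ} → (∀ i → 1 ≤ t i) →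
    sumFin t ≤ sumFin (blockSum S t) → ∀ i → ∃[ j ] S j i ≡ true
  blocks-cover disjoint {t} t≥1 Σt≤ i with any? (λ j → S j i Boolₚ.≟ true)
  ... | yes covered  = covered
  ... | no uncovered = contradiction Σt≤ (<⇒≱ (begin-strict
    sumFin (blockSum S t) ≡⟨ sumFin-comm (λ j i → if S j i then t i else 0) ⟩
    sumFin share          <⟨ sumFin-mono-< share≤t i (subst (_< t i) (sym share≡0) (t≥1 i)) ⟩
    sumFin t              ∎))
    where
    open ≤-Reasoning
    share : Fin s → ℕ
    share k = sumFin (λ j → if S j k then t k else 0)
    share≤t : ∀ k → share k ≤ t k
    share≤t k = sumFin-if-unique-≤ (λ j → S j k) (t k) (λ j j' → disjoint j j' k)
    share≡0 : share i ≡ 0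
    share≡0 = sumFin-if-false (λ j → S j i) (t i) (λ j → Boolₚ.¬-not (uncovered ∘ (j ,_)))

  module _ (r<s : r < s) {c : Fin s → ℕ} (c≥1 : ∀ i → 1 ≤ c i)
           (cover : ∀ i → ∃[ j ] S j i ≡ true) where

    ∃-term<blockSum : ∃[ i ] c i < blockSum S c (proj₁ (cover i))
    ∃-term<blockSum with pigeonhole r<s (proj₁ ∘ cover)
    ... | i₁ , i₂ , i₁<i₂ , same-block = i₁ , <-≤-trans (m<m+n (c i₁) (c≥1 i₂))
      (two-terms≤blockSum c (Finₚ.<⇒≢ i₁<i₂) (proj₂ (cover i₁))
        (subst (λ j → S j i₂ ≡ true) (sym same-block) (proj₂ (cover i₂))))

    expEntropy-<-blockSum : ∀ {t : Fin s → ℕ} → (∀ i → 1 ≤ t i) →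
      expEntropy t c < expEntropy (blockSum S t) (blockSum S c)
    expEntropy-<-blockSum {t} t≥1 = begin-strict
      prodFin (λ i → c i ^ t i)                         <⟨ prodFin-mono-< c^t≥1 c^t≤G i₁ c^t<G ⟩
      prodFin G                                         ≡⟨ prodFin-comm (λ i j → C j ^ e i j) ⟩
      prodFin (λ j → prodFin (λ i → C j ^ e i j))       ≡⟨ prodFin-cong (λ j → ^-distribˡ-sumFin (C j) (flip e j)) ⟨
      prodFin (λ j → C j ^ blockSum S t j)              ∎
      where
      open ≤-Reasoning
      C : Fin r → ℕ
      C = blockSum S c
      σ : Fin s → Fin r
      σ = proj₁ ∘ cover
      e : Fin s → Fin r → ℕ
      e i j = if S j i then t i else 0
      G : Fin s → ℕ
      G i = prodFin (λ j → C j ^ e i j)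
      c^t≥1 : ∀ i → 1 ≤ c i ^ t i
      c^t≥1 i = m^n>0 (c i) {{>-nonZero (c≥1 i)}} (t i)
      factor≥1 : ∀ i j → 1 ≤ C j ^ e i j
      factor≥1 i j with S j i in Sji
      ... | true  = m^n>0 (C j) {{>-nonZero (≤-trans (c≥1 i) (term≤blockSum c Sji))}} (t i)
      ... | false = ≤-refl
      C^t≤G : ∀ i → C (σ i) ^ t i ≤ G i
      C^t≤G i = subst (_≤ G i) (cong (λ b → C (σ i) ^ (if b then t i else 0)) (proj₂ (cover i)))
                  (factor≤prodFin (factor≥1 i) (σ i))
      c^t≤G : ∀ i → c i ^ t i ≤ G i
      c^t≤G i = ≤-trans (^-monoˡ-≤ (t i) (term≤blockSum c (proj₂ (cover i)))) (C^t≤G i)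
      i₁ : Fin s
      i₁ = proj₁ ∃-term<blockSum
      c^t<G : c i₁ ^ t i₁ < G i₁
      c^t<G = <-≤-trans (^-monoˡ-< (t i₁) {{>-nonZero (t≥1 i₁)}} (proj₂ ∃-term<blockSum)) (C^t≤G i₁)

theorem3 : (n : ℕ) (f f' : Fin n → Fin n)
    (s r : ℕ) (t c : Fin s → ℕ) (t' c' : Fin r → ℕ) →
    Components f s t c → Components f' r t' c' →
    Prec s r t c t' c' →
    expEntropy t c < expEntropy t' c'
theorem3 n f f' s r t c t' c' C C' (r<s , S , disjoint , t'≡ , c'≡) = begin-strict
  expEntropy t c
    <⟨ expEntropy-<-blockSum S r<s (cycleSize-pos C) cover (size-pos C) ⟩
  expEntropy (blockSum S t) (blockSum S c)
    ≡⟨ prodFin-cong (λ j → cong₂ _^_ (c'≡ j) (t'≡ j)) ⟨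
  expEntropy t' c' ∎
  where
  open ≤-Reasoning
  Σt≡Σblocks : sumFin t ≡ sumFin (blockSum S t)
  Σt≡Σblocks = trans (sumFin-size C) (trans (sym (sumFin-size C')) (sumFin-cong t'≡))
  cover : ∀ i → ∃[ j ] S j i ≡ true
  cover = blocks-cover S disjoint (size-pos C) (≤-reflexive Σt≡Σblocks)
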